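{- For every integer $n\ge 0$, $D_3(n)=3^{\mathrm{wt}(n)}$, where $\mathrm{wt}(n)$ is the number of ones in the binary expansion of $n$.
   Context: A P-position of the game of Nim with $k$ piles is a $k$-tuple $(p_1,\dots,p_k)$ of non-negative integers whose nim-sum $p_1\oplus\cdots\oplus p_k$ is $0$, where $\oplus$ denotes bitwise XOR. $D_k(n)$ denotes the number of P-positions with $k$ piles whose total number of counters $p_1+\cdots+p_k$ equals exactly $2n$. -}

module Defs where

open import Data.Nat using (ℕ; zero; suc; _+_; _*_; _∸_; _≤ᵇ_; _≡ᵇ_)
open import Data.Nat.DivMod using (_/_; _%_)
open import Data.Bool using (Bool; true; false; if_then_else_; _∧_)
open import Data.List using (List; upTo; length; filter; concatMap; map; []; _∷_)
open import Data.Product using (_×_; _,_)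
open import Relation.Nullary.Decidable using (does)
open import Data.Bool.Properties using (_≟_)

-- The fuel argument bounds the number of bit-steps; with fuel ≥ a + b
-- (more than the number of binary digits of a and b) the result is exact.
xorFuel : ℕ → ℕ → ℕ → ℕ
xorFuel zero    a b = 0
xorFuel (suc f) a b =
  (if (a % 2) ≡ᵇ (b % 2) then 0 else 1) + 2 * xorFuel f (a / 2) (b / 2)

infixl 6 _⊕_
_⊕_ : ℕ → ℕ → ℕ
a ⊕ b = xorFuel (a + b) a b

wtFuel : ℕ → ℕ → ℕ
wtFuel zero    n = 0
wtFuel (suc f) n = n % 2 + wtFuel f (n / 2)

wt : ℕ → ℕ
wt n = wtFuel n n

triplesSummingTo : ℕ → List (ℕ × ℕ × ℕ)
triplesSummingTo m =
  concatMap (λ p₁ → map (λ p₂ → (p₁ , p₂ , (m ∸ p₁) ∸ p₂)) (upTo (suc (m ∸ p₁))))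
            (upTo (suc m))

isP : ℕ × ℕ × ℕ → Bool
isP (p₁ , p₂ , p₃) = (p₁ ⊕ p₂ ⊕ p₃) ≡ᵇ 0

-- D₃(n): number of P-positions of 3-pile Nim with exactly 2n counters.
D₃ : ℕ → ℕ
D₃ n = length (filter (λ t → isP t Data.Bool.≟ true) (triplesSummingTo (2 * n)))

-- Let T m count the P-positions (a, b, c) with a + b + c = m, so that D₃ n = T (2n). Splitting
-- off the last binary digit of each pile, (2a + i, 2b + j, 2c + k) is a P-position iff
-- i ⊕ j ⊕ k = 0 and (a, b, c) is one; hence either no pile or exactly two piles are odd. This
-- gives T (2m + 1) = 0 and T (2m) = T m + 3 T (m - 1), so D₃ (2n) = D₃ n and
-- D₃ (2n + 1) = 3 D₃ n, which are the recurrences satisfied by 3 ^ wt n.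

module Submission where

open import Data.Bool using (Bool; true; false; if_then_else_; _xor_)
open import Data.Bool.Properties using (_≟_)
open import Data.List using (List; []; _∷_; _++_; map; length; filter; concatMap; upTo; applyUpTo)
open import Data.List.Properties using (map-applyUpTo; map-++; map-∘; map-cong)
open import Data.Nat using (ℕ; zero; suc; _+_; _*_; _∸_; _^_; _≤_; _<_; z≤n; s≤s; _≡ᵇ_)
open import Data.Nat.Divisibility using (n∣m*n)
open import Data.Nat.DivMod using (_/_; _%_; [m+kn]%n≡m%n; +-distrib-/-∣ʳ; m*n/n≡m; m/n<m)
open import Data.Nat.Induction using (<-rec)
open import Data.Nat.ListAction using (sum)
open import Data.Nat.ListAction.Properties using (sum-++)
open import Data.Nat.Properties
  using ( +-commutativeSemigroup; +-assoc; +-identityʳ; *-comm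
        ; ≤-refl; ≤-trans; m≤m+n; m≤n+m; m≤n⇒m≤1+n )
open import Algebra.Properties.CommutativeSemigroup +-commutativeSemigroup using (interchange)
open import Data.Nat.Tactic.RingSolver using (solve-∀)
open import Data.Product using (_×_; _,_)
open import Defs
open import Function using (_∘_)
open import Relation.Binary.PropositionalEquality
open ≡-Reasoning

double : ℕ → ℕ
double zero    = zero
double (suc n) = suc (suc (double n))

double≡*2 : ∀ n → double n ≡ n * 2
double≡*2 zero    = refl
double≡*2 (suc n) = cong (suc ∘ suc) (double≡*2 n)

bit : Bool → ℕ
bit false = 0
bit true  = 1

digit-%2 : ∀ i n → (bit i + double n) % 2 ≡ bit i
digit-%2 false n rewrite double≡*2 n = [m+kn]%n≡m%n 0 n 2
digit-%2 true  n rewrite double≡*2 n = [m+kn]%n≡m%n 1 n 2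

digit-/2 : ∀ i n → (bit i + double n) / 2 ≡ n
digit-/2 false n rewrite double≡*2 n = trans (+-distrib-/-∣ʳ 0 {d = 2} (n∣m*n n)) (m*n/n≡m n 2)
digit-/2 true  n rewrite double≡*2 n = trans (+-distrib-/-∣ʳ 1 {d = 2} (n∣m*n n)) (m*n/n≡m n 2)

m≤1+n⇒m/2≤n : ∀ {m n} → m ≤ suc n → m / 2 ≤ n
m≤1+n⇒m/2≤n {zero}  _         = z≤n
m≤1+n⇒m/2≤n {suc m} 1+m≤1+n with ≤-trans (m/n<m (suc m) 2 (s≤s (s≤s z≤n))) 1+m≤1+n
... | s≤s m/2≤n = m/2≤n

xorFuel-0-0 : ∀ f → xorFuel f 0 0 ≡ 0
xorFuel-0-0 zero    = refl
xorFuel-0-0 (suc f) = cong (2 *_) (xorFuel-0-0 f)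

xorFuel-irrelevant : ∀ {f g a b} → a ≤ f → b ≤ f → a ≤ g → b ≤ g → xorFuel f a b ≡ xorFuel g a b
xorFuel-irrelevant {zero}  {g}     z≤n z≤n _   _   = sym (xorFuel-0-0 g)
xorFuel-irrelevant {suc f} {zero}  _   _   z≤n z≤n = xorFuel-0-0 (suc f)
xorFuel-irrelevant {suc f} {suc g} {a} {b} a≤f b≤f a≤g b≤g =
  cong (λ x → (if (a % 2) ≡ᵇ (b % 2) then 0 else 1) + 2 * x)
    (xorFuel-irrelevant (m≤1+n⇒m/2≤n a≤f) (m≤1+n⇒m/2≤n b≤f) (m≤1+n⇒m/2≤n a≤g) (m≤1+n⇒m/2≤n b≤g))

⊕-unfold : ∀ a b → a ⊕ b ≡ (if (a % 2) ≡ᵇ (b % 2) then 0 else 1) + 2 * (a / 2 ⊕ b / 2)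
⊕-unfold zero    zero    = refl
⊕-unfold zero    (suc b) =
  cong (λ x → (if 0 ≡ᵇ (suc b % 2) then 0 else 1) + 2 * x)
    (xorFuel-irrelevant {b} z≤n (m≤1+n⇒m/2≤n ≤-refl) z≤n ≤-refl)
⊕-unfold (suc a) b =
  cong (λ x → (if (suc a % 2) ≡ᵇ (b % 2) then 0 else 1) + 2 * x)
    (xorFuel-irrelevant (m≤1+n⇒m/2≤n (s≤s (m≤m+n a b))) (m≤1+n⇒m/2≤n (m≤n⇒m≤1+n (m≤n+m b a)))
                        (m≤m+n _ _) (m≤n+m _ _))

⊕-digits : ∀ i j a b → (bit i + double a) ⊕ (bit j + double b) ≡ bit (i xor j) + double (a ⊕ b)
⊕-digits i j a b
  rewrite ⊕-unfold (bit i + double a) (bit j + double b)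
        | digit-%2 i a | digit-%2 j b | digit-/2 i a | digit-/2 j b
        = cong₂ _+_ (bitXor i j) (trans (*-comm 2 (a ⊕ b)) (sym (double≡*2 (a ⊕ b))))
  where
  bitXor : ∀ i j → (if bit i ≡ᵇ bit j then 0 else 1) ≡ bit (i xor j)
  bitXor false false = refl
  bitXor false true  = refl
  bitXor true  false = refl
  bitXor true  true  = refl

wtFuel-0 : ∀ f → wtFuel f 0 ≡ 0
wtFuel-0 zero    = refl
wtFuel-0 (suc f) = wtFuel-0 f

wtFuel-irrelevant : ∀ {f g n} → n ≤ f → n ≤ g → wtFuel f n ≡ wtFuel g n
wtFuel-irrelevant {zero}  {g}     z≤n _   = sym (wtFuel-0 g)
wtFuel-irrelevant {suc f} {zero}  _   z≤n = wtFuel-0 (suc f)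
wtFuel-irrelevant {suc f} {suc g} {n} n≤f n≤g =
  cong (n % 2 +_) (wtFuel-irrelevant (m≤1+n⇒m/2≤n n≤f) (m≤1+n⇒m/2≤n n≤g))

wt-unfold : ∀ n → wt n ≡ n % 2 + wt (n / 2)
wt-unfold zero    = refl
wt-unfold (suc n) = cong (suc n % 2 +_) (wtFuel-irrelevant {n} (m≤1+n⇒m/2≤n ≤-refl) ≤-refl)

wt-digit : ∀ i n → wt (bit i + double n) ≡ bit i + wt n
wt-digit i n = trans (wt-unfold (bit i + double n)) (cong₂ _+_ (digit-%2 i n) (cong wt (digit-/2 i n)))

n≤double : ∀ n → n ≤ double n
n≤double zero    = z≤n
n≤double (suc n) = s≤s (m≤n⇒m≤1+n (n≤double n))

data Parity : ℕ → Set where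
  even : ∀ k → Parity (double k)
  odd  : ∀ k → Parity (suc (double k))

parity : ∀ n → Parity n
parity zero = even zero
parity (suc n) with parity n
... | even k = odd k
... | odd k  = even (suc k)

binary-recurrence⇒≡^wt : ∀ (c : ℕ) (f : ℕ → ℕ) → f 0 ≡ 1 →
  (∀ n → f (double n) ≡ f n) → (∀ n → f (suc (double n)) ≡ c * f n) → ∀ n → f n ≡ c ^ wt n
binary-recurrence⇒≡^wt c f f0≡1 f-even f-odd = <-rec (λ n → f n ≡ c ^ wt n) step
  where
  step : ∀ n → (∀ {m} → m < n → f m ≡ c ^ wt m) → f n ≡ c ^ wt n
  step n rec with parity n
  ... | even zero    = f0≡1
  ... | even (suc k) = begin
    f (double (suc k))    ≡⟨ f-even (suc k) ⟩
    f (suc k)             ≡⟨ rec (s≤s (s≤s (n≤double k))) ⟩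
    c ^ wt (suc k)        ≡⟨ cong (c ^_) (wt-digit false (suc k)) ⟨
    c ^ wt (double (suc k)) ∎
  ... | odd k = begin
    f (suc (double k))    ≡⟨ f-odd k ⟩
    c * f k               ≡⟨ cong (c *_) (rec (s≤s (n≤double k))) ⟩
    c ^ suc (wt k)        ≡⟨ cong (c ^_) (wt-digit true k) ⟨
    c ^ wt (suc (double k)) ∎

antidiagonalSum : ℕ → (ℕ → ℕ → ℕ) → ℕ
antidiagonalSum zero    g = g 0 0
antidiagonalSum (suc m) g = g 0 (suc m) + antidiagonalSum m (λ a b → g (suc a) b)

-- The sum over a + b + 1 = m; unlike the sum over a + b = m ∸ 1 it is empty for m = 0.
antidiagonalSum⁻ : ℕ → (ℕ → ℕ → ℕ) → ℕ
antidiagonalSum⁻ zero    g = 0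
antidiagonalSum⁻ (suc m) g = antidiagonalSum m g

antidiagonalSum-cong : ∀ m {g h : ℕ → ℕ → ℕ} → (∀ a b → g a b ≡ h a b) →
                       antidiagonalSum m g ≡ antidiagonalSum m h
antidiagonalSum-cong zero    g≡h = g≡h 0 0
antidiagonalSum-cong (suc m) g≡h =
  cong₂ _+_ (g≡h 0 (suc m)) (antidiagonalSum-cong m (λ a → g≡h (suc a)))

antidiagonalSum⁻-cong : ∀ m {g h : ℕ → ℕ → ℕ} → (∀ a b → g a b ≡ h a b) →
                        antidiagonalSum⁻ m g ≡ antidiagonalSum⁻ m h
antidiagonalSum⁻-cong zero    g≡h = refl
antidiagonalSum⁻-cong (suc m) g≡h = antidiagonalSum-cong m g≡h

antidiagonalSum-≡0 : ∀ m {g : ℕ → ℕ → ℕ} → (∀ a b → g a b ≡ 0) → antidiagonalSum m g ≡ 0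
antidiagonalSum-≡0 zero    g≡0 = g≡0 0 0
antidiagonalSum-≡0 (suc m) g≡0 =
  cong₂ _+_ (g≡0 0 (suc m)) (antidiagonalSum-≡0 m (λ a → g≡0 (suc a)))

antidiagonalSum⁻-≡0 : ∀ m {g : ℕ → ℕ → ℕ} → (∀ a b → g a b ≡ 0) → antidiagonalSum⁻ m g ≡ 0
antidiagonalSum⁻-≡0 zero    g≡0 = refl
antidiagonalSum⁻-≡0 (suc m) g≡0 = antidiagonalSum-≡0 m g≡0

antidiagonalSum-+ : ∀ m (g h : ℕ → ℕ → ℕ) →
  antidiagonalSum m (λ a b → g a b + h a b) ≡ antidiagonalSum m g + antidiagonalSum m h
antidiagonalSum-+ zero    g h = refl
antidiagonalSum-+ (suc m) g h =
  trans (cong (g 0 (suc m) + h 0 (suc m) +_) (antidiagonalSum-+ m (λ a → g (suc a)) (λ a → h (suc a))))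
        (interchange (g 0 (suc m)) (h 0 (suc m)) _ _)

antidiagonalSum⁻-+ : ∀ m (g h : ℕ → ℕ → ℕ) →
  antidiagonalSum⁻ m (λ a b → g a b + h a b) ≡ antidiagonalSum⁻ m g + antidiagonalSum⁻ m h
antidiagonalSum⁻-+ zero    g h = refl
antidiagonalSum⁻-+ (suc m) g h = antidiagonalSum-+ m g h

antidiagonalSum-head : ∀ m (g : ℕ → ℕ → ℕ) →
  antidiagonalSum m g ≡ g 0 m + antidiagonalSum⁻ m (λ a b → g (suc a) b)
antidiagonalSum-head zero    g = sym (+-identityʳ (g 0 0))
antidiagonalSum-head (suc m) g = refl

antidiagonalSum-last : ∀ m (g : ℕ → ℕ → ℕ) →
  antidiagonalSum (suc m) g ≡ antidiagonalSum m (λ a b → g a (suc b)) + g (suc m) 0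
antidiagonalSum-last zero    g = refl
antidiagonalSum-last (suc m) g =
  trans (cong (g 0 (suc (suc m)) +_) (antidiagonalSum-last m (λ a → g (suc a))))
        (sym (+-assoc (g 0 (suc (suc m))) _ _))

-- Both sides sum G a b c over a + b + c + 1 = n.
antidiagonalSum-antidiagonalSum⁻ : ∀ n (G : ℕ → ℕ → ℕ → ℕ) →
  antidiagonalSum n (λ a r → antidiagonalSum⁻ r (G a)) ≡
  antidiagonalSum⁻ n (λ a r → antidiagonalSum r (G a))
antidiagonalSum-antidiagonalSum⁻ zero    G = refl
antidiagonalSum-antidiagonalSum⁻ (suc n) G =
  trans (antidiagonalSum-last n (λ a r → antidiagonalSum⁻ r (G a))) (+-identityʳ _)

private
  regroup : ∀ x y a b → x + (y + (a + b)) ≡ (x + a) + (y + b)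
  regroup x y a b = trans (sym (+-assoc x y (a + b))) (interchange x y a b)

antidiagonalSum-double : ∀ j (g : ℕ → ℕ → ℕ) →
  antidiagonalSum (double j) g ≡
    antidiagonalSum j (λ a b → g (double a) (double b)) +
    antidiagonalSum⁻ j (λ a b → g (suc (double a)) (suc (double b)))
antidiagonalSum-double zero    g = sym (+-identityʳ (g 0 0))
antidiagonalSum-double (suc j) g = begin
  antidiagonalSum (double (suc j)) g
    ≡⟨⟩
  g 0 (double (suc j)) + (g 1 (suc (double j)) + antidiagonalSum (double j) (λ a → g (2 + a)))
    ≡⟨ cong (λ s → g 0 (double (suc j)) + (g 1 (suc (double j)) + s))
            (antidiagonalSum-double j (λ a → g (2 + a))) ⟩
  g 0 (double (suc j)) + (g 1 (suc (double j)) + (evenPart + oddPart))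
    ≡⟨ regroup (g 0 (double (suc j))) (g 1 (suc (double j))) evenPart oddPart ⟩
  (g 0 (double (suc j)) + evenPart) + (g 1 (suc (double j)) + oddPart)
    ≡⟨ cong (g 0 (double (suc j)) + evenPart +_)
            (sym (antidiagonalSum-head j (λ a b → g (suc (double a)) (suc (double b))))) ⟩
  antidiagonalSum (suc j) (λ a b → g (double a) (double b)) +
  antidiagonalSum j (λ a b → g (suc (double a)) (suc (double b))) ∎
  where
  evenPart oddPart : ℕ
  evenPart = antidiagonalSum j (λ a b → g (double (suc a)) (double b))
  oddPart  = antidiagonalSum⁻ j (λ a b → g (suc (double (suc a))) (suc (double b)))

antidiagonalSum-sucDouble : ∀ j (g : ℕ → ℕ → ℕ) →
  antidiagonalSum (suc (double j)) g ≡
    antidiagonalSum j (λ a b → g (double a) (suc (double b))) +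
    antidiagonalSum j (λ a b → g (suc (double a)) (double b))
antidiagonalSum-sucDouble zero    g = refl
antidiagonalSum-sucDouble (suc j) g =
  trans (cong (λ s → g 0 (suc (double (suc j))) + (g 1 (double (suc j)) + s))
              (antidiagonalSum-sucDouble j (λ a → g (2 + a))))
        (regroup (g 0 (suc (double (suc j)))) (g 1 (double (suc j)))
                 (antidiagonalSum j (λ a b → g (double (suc a)) (suc (double b))))
                 (antidiagonalSum j (λ a b → g (suc (double (suc a))) (double b))))

sum-applyUpTo-antidiagonal : ∀ m (g : ℕ → ℕ → ℕ) →
  sum (applyUpTo (λ i → g i (m ∸ i)) (suc m)) ≡ antidiagonalSum m g
sum-applyUpTo-antidiagonal zero    g = +-identityʳ (g 0 0)
sum-applyUpTo-antidiagonal (suc m) g =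
  cong (g 0 (suc m) +_) (sum-applyUpTo-antidiagonal m (λ a → g (suc a)))

sum-map-antidiagonal : ∀ m (g : ℕ → ℕ → ℕ) →
  sum (map (λ i → g i (m ∸ i)) (upTo (suc m))) ≡ antidiagonalSum m g
sum-map-antidiagonal m g =
  trans (cong sum (map-applyUpTo (λ i → i) (λ i → g i (m ∸ i)) (suc m))) (sum-applyUpTo-antidiagonal m g)

length-filter≡sum-bit : ∀ {A : Set} (p : A → Bool) (xs : List A) →
  length (filter (λ x → p x ≟ true) xs) ≡ sum (map (bit ∘ p) xs)
length-filter≡sum-bit p []       = refl
length-filter≡sum-bit p (x ∷ xs) with p x
... | true  = cong suc (length-filter≡sum-bit p xs)
... | false = length-filter≡sum-bit p xs

sum-map-concatMap : ∀ {A B : Set} (f : B → ℕ) (g : A → List B) (xs : List A) →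
  sum (map f (concatMap g xs)) ≡ sum (map (sum ∘ map f ∘ g) xs)
sum-map-concatMap f g []       = refl
sum-map-concatMap f g (x ∷ xs) = begin
  sum (map f (g x ++ concatMap g xs))
    ≡⟨ cong sum (map-++ f (g x) (concatMap g xs)) ⟩
  sum (map f (g x) ++ map f (concatMap g xs))
    ≡⟨ sum-++ (map f (g x)) (map f (concatMap g xs)) ⟩
  sum (map f (g x)) + sum (map f (concatMap g xs))
    ≡⟨ cong (sum (map f (g x)) +_) (sum-map-concatMap f g xs) ⟩
  sum (map (sum ∘ map f ∘ g) (x ∷ xs)) ∎

χP : ℕ → ℕ → ℕ → ℕ
χP a b c = bit (isP (a , b , c))

double≡ᵇ0 : ∀ n → (double n ≡ᵇ 0) ≡ (n ≡ᵇ 0)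
double≡ᵇ0 zero    = refl
double≡ᵇ0 (suc n) = refl

χP-digits : ∀ i j k a b c →
  χP (bit i + double a) (bit j + double b) (bit k + double c) ≡
  (if (i xor j) xor k then 0 else χP a b c)
χP-digits i j k a b c
  rewrite ⊕-digits i j a b | ⊕-digits (i xor j) k (a ⊕ b) c
  with (i xor j) xor k
... | true  = refl
... | false = cong bit (double≡ᵇ0 (a ⊕ b ⊕ c))

pCountWith : ℕ → ℕ → ℕ
pCountWith a r = antidiagonalSum r (χP a)

pCount : ℕ → ℕ
pCount m = antidiagonalSum m pCountWith

pCount⁻ : ℕ → ℕ
pCount⁻ m = antidiagonalSum⁻ m pCountWith

length-filter-triplesSummingTo : ∀ m →
  length (filter (λ t → isP t ≟ true) (triplesSummingTo m)) ≡ pCount m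
length-filter-triplesSummingTo m = begin
  length (filter (λ t → isP t ≟ true) (triplesSummingTo m))
    ≡⟨ length-filter≡sum-bit isP (triplesSummingTo m) ⟩
  sum (map (bit ∘ isP) (triplesSummingTo m))
    ≡⟨ sum-map-concatMap (bit ∘ isP) row (upTo (suc m)) ⟩
  sum (map (sum ∘ map (bit ∘ isP) ∘ row) (upTo (suc m)))
    ≡⟨ cong sum (map-cong rowSum (upTo (suc m))) ⟩
  sum (map (λ a → pCountWith a (m ∸ a)) (upTo (suc m)))
    ≡⟨ sum-map-antidiagonal m pCountWith ⟩
  pCount m ∎
  where
  row : ℕ → List (ℕ × ℕ × ℕ)
  row a = map (λ b → (a , b , (m ∸ a) ∸ b)) (upTo (suc (m ∸ a)))
  rowSum : ∀ a → sum (map (bit ∘ isP) (row a)) ≡ pCountWith a (m ∸ a)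
  rowSum a = trans (cong sum (sym (map-∘ (upTo (suc (m ∸ a)))))) (sum-map-antidiagonal (m ∸ a) (χP a))

pCountWith-even-even : ∀ a r →
  pCountWith (double a) (double r) ≡ pCountWith a r + antidiagonalSum⁻ r (χP a)
pCountWith-even-even a r = trans (antidiagonalSum-double r (χP (double a)))
  (cong₂ _+_ (antidiagonalSum-cong r (χP-digits false false false a))
             (antidiagonalSum⁻-cong r (χP-digits false true true a)))

pCountWith-odd-odd : ∀ a r →
  pCountWith (suc (double a)) (suc (double r)) ≡ pCountWith a r + pCountWith a r
pCountWith-odd-odd a r = trans (antidiagonalSum-sucDouble r (χP (suc (double a))))
  (cong₂ _+_ (antidiagonalSum-cong r (χP-digits true false true a))
             (antidiagonalSum-cong r (χP-digits true true false a)))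

pCountWith-even-odd : ∀ a r → pCountWith (double a) (suc (double r)) ≡ 0
pCountWith-even-odd a r = trans (antidiagonalSum-sucDouble r (χP (double a)))
  (cong₂ _+_ (antidiagonalSum-≡0 r (χP-digits false false true a))
             (antidiagonalSum-≡0 r (χP-digits false true false a)))

pCountWith-odd-even : ∀ a r → pCountWith (suc (double a)) (double r) ≡ 0
pCountWith-odd-even a r = trans (antidiagonalSum-double r (χP (suc (double a))))
  (cong₂ _+_ (antidiagonalSum-≡0 r (χP-digits true false false a))
             (antidiagonalSum⁻-≡0 r (χP-digits true true true a)))

-- A P-position has an even number of odd piles: none, or two, chosen in three ways.
pCount-double : ∀ n → pCount (double n) ≡ pCount n + 3 * pCount⁻ n
pCount-double n = begin
  pCount (double n)
    ≡⟨ antidiagonalSum-double n pCountWith ⟩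
  antidiagonalSum n (λ a r → pCountWith (double a) (double r)) +
  antidiagonalSum⁻ n (λ a r → pCountWith (suc (double a)) (suc (double r)))
    ≡⟨ cong₂ _+_ (antidiagonalSum-cong n pCountWith-even-even) (antidiagonalSum⁻-cong n pCountWith-odd-odd) ⟩
  antidiagonalSum n (λ a r → pCountWith a r + antidiagonalSum⁻ r (χP a)) +
  antidiagonalSum⁻ n (λ a r → pCountWith a r + pCountWith a r)
    ≡⟨ cong₂ _+_ (antidiagonalSum-+ n pCountWith (λ a r → antidiagonalSum⁻ r (χP a)))
                 (antidiagonalSum⁻-+ n pCountWith pCountWith) ⟩
  (pCount n + antidiagonalSum n (λ a r → antidiagonalSum⁻ r (χP a))) + (pCount⁻ n + pCount⁻ n)
    ≡⟨ cong (λ s → pCount n + s + (pCount⁻ n + pCount⁻ n)) (antidiagonalSum-antidiagonalSum⁻ n χP) ⟩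
  (pCount n + pCount⁻ n) + (pCount⁻ n + pCount⁻ n)
    ≡⟨ x+y+[y+y]≡x+3y (pCount n) (pCount⁻ n) ⟩
  pCount n + 3 * pCount⁻ n ∎
  where
  x+y+[y+y]≡x+3y : ∀ x y → (x + y) + (y + y) ≡ x + 3 * y
  x+y+[y+y]≡x+3y = solve-∀

pCount-sucDouble : ∀ n → pCount (suc (double n)) ≡ 0
pCount-sucDouble n = trans (antidiagonalSum-sucDouble n pCountWith)
  (cong₂ _+_ (antidiagonalSum-≡0 n pCountWith-even-odd) (antidiagonalSum-≡0 n pCountWith-odd-even))

pCount⁻-double : ∀ n → pCount⁻ (double n) ≡ 0
pCount⁻-double zero    = refl
pCount⁻-double (suc n) = pCount-sucDouble n

pCount-double-double : ∀ n → pCount (double (double n)) ≡ pCount (double n)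
pCount-double-double n = begin
  pCount (double (double n))                 ≡⟨ pCount-double (double n) ⟩
  pCount (double n) + 3 * pCount⁻ (double n) ≡⟨ cong (λ s → pCount (double n) + 3 * s) (pCount⁻-double n) ⟩
  pCount (double n) + 0                      ≡⟨ +-identityʳ (pCount (double n)) ⟩
  pCount (double n)                          ∎

pCount-double-sucDouble : ∀ n → pCount (double (suc (double n))) ≡ 3 * pCount (double n)
pCount-double-sucDouble n =
  trans (pCount-double (suc (double n))) (cong (_+ 3 * pCount (double n)) (pCount-sucDouble n))

theorem19 : (n : ℕ) → D₃ n ≡ 3 ^ wt n
theorem19 n = begin
  D₃ n              ≡⟨ length-filter-triplesSummingTo (2 * n) ⟩
  pCount (2 * n)    ≡⟨ cong pCount (trans (*-comm 2 n) (sym (double≡*2 n))) ⟩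
  pCount (double n) ≡⟨ binary-recurrence⇒≡^wt 3 (pCount ∘ double) refl
                         pCount-double-double pCount-double-sucDouble n ⟩
  3 ^ wt n          ∎
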